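{- Let $M$ be a matroid on an $n$-element ground set $E$, let $1\le k\le n-r(M)$, and let $0\le j\le n$. If \[P_{M_{k-1},j}(Z)=a_{n}Z^{n}+a_{n-1}Z^{n-1}+\cdots+a_{1}Z+a_{0},\] then \[P_{M_{k},j}(Z)=a_{n}Z^{n-1}+a_{n-1}Z^{n-2}+\cdots+a_{2}Z+(a_{1}+a_{0}).\]
   Context: For a matroid $N$ on $E$ with rank function $r_N$, the nullity is $n_N(\sigma)=|\sigma|-r_N(\sigma)$, and $r(N)=r_N(E)$. For $0\le l\le n-r(M)$, the elongation $M_l$ is the matroid on $E$ whose independent sets are $\{\sigma\subseteq E:n_M(\sigma)\le l\}$ ($M_0=M$). Generalized weight polynomials of a matroid $N$ on $E$: $P_{N,0}(Z)=1$ and, for $1\le j\le n$, $P_{N,j}(Z)=(-1)^j\sum_{\sigma\subseteq E,\,|\sigma|=j}\sum_{\gamma\subseteq\sigma}(-1)^{|\gamma|}Z^{n_N(\gamma)}$. -}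

module Defs where

open import Data.Bool using (Bool; true; false; _∧_; _∨_; not; if_then_else_)
open import Data.Nat using (ℕ; zero; suc; _∸_; _<_; _≤ᵇ_; _≡ᵇ_; _⊔_)
open import Data.Integer using (ℤ; -1ℤ; 1ℤ; 0ℤ; _^_; _*_; _+_)
open import Data.Fin using (Fin)
open import Data.Fin.Subset using (Subset; outside; inside; ⊥; ∣_∣; _∈_; _∉_; _⊆_; _∪_; ⁅_⁆)
open import Data.Vec using ([]; _∷_)
open import Data.List using (List; []; _∷_; _++_; map; foldr)
open import Data.Product using (∃; _×_)
open import Relation.Binary.PropositionalEquality using (_≡_)

allSubsets : (n : ℕ) → List (Subset n)
allSubsets zero = [] ∷ []
allSubsets (suc n) = map (outside ∷_) (allSubsets n) ++ map (inside ∷_) (allSubsets n)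

_⊆ᵇ_ : ∀ {n} → Subset n → Subset n → Bool
[] ⊆ᵇ [] = true
(a ∷ p) ⊆ᵇ (b ∷ q) = (not a ∨ b) ∧ (p ⊆ᵇ q)

sumℤ : List ℤ → ℤ
sumℤ = foldr _+_ 0ℤ

record Matroid (n : ℕ) : Set where
  field
    indep    : Subset n → Bool
    indep-⊥  : indep ⊥ ≡ true
    indep-⊆  : ∀ I J → J ⊆ I → indep I ≡ true → indep J ≡ true
    indep-aug : ∀ I J → indep I ≡ true → indep J ≡ true → ∣ I ∣ < ∣ J ∣ →
                ∃ λ x → x ∈ J × x ∉ I × indep (I ∪ ⁅ x ⁆) ≡ true
open Matroid public

rankI : ∀ {n} → (Subset n → Bool) → Subset n → ℕ
rankI {n} ind σ =
  foldr _⊔_ 0 (map (λ τ → if (τ ⊆ᵇ σ) ∧ ind τ then ∣ τ ∣ else 0) (allSubsets n))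

nullityI : ∀ {n} → (Subset n → Bool) → Subset n → ℕ
nullityI ind σ = ∣ σ ∣ ∸ rankI ind σ

rank : ∀ {n} → Matroid n → Subset n → ℕ
rank M = rankI (indep M)

nullity : ∀ {n} → Matroid n → Subset n → ℕ
nullity M = nullityI (indep M)

rk : ∀ {n} → Matroid n → ℕ
rk M = rank M Data.Fin.Subset.⊤

elongation : ∀ {n} → Matroid n → ℕ → Subset n → Bool
elongation M l σ = nullity M σ ≤ᵇ l

-- Coefficient of Z^i in the generalized weight polynomial P_{N,j}(Z),
-- where N is given by its independent sets `ind`.
-- P_{N,0} = 1;  P_{N,j} = (-1)^j Σ_{|σ|=j} Σ_{γ⊆σ} (-1)^{|γ|} Z^{n_N(γ)}.
weightCoeff : ∀ {n} → (Subset n → Bool) → ℕ → ℕ → ℤ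
weightCoeff ind zero i = if i ≡ᵇ 0 then 1ℤ else 0ℤ
weightCoeff {n} ind (suc j) i =
  (-1ℤ ^ suc j) * sumℤ (map (λ σ →
     if ∣ σ ∣ ≡ᵇ suc j
     then sumℤ (map (λ γ →
            if (γ ⊆ᵇ σ) ∧ (nullityI ind γ ≡ᵇ i) then -1ℤ ^ ∣ γ ∣ else 0ℤ)
          (allSubsets n))
     else 0ℤ) (allSubsets n))

-- Elongating once more lowers every nullity by one, and the weight polynomials
-- follow:  P_{M_k,j}(Z) is obtained from P_{M_{k-1},j}(Z) by dividing by Z, the
-- constant term being merged into the linear one.
--
-- For a family of "independent" sets containing ∅,
--   the rank of γ in the elongation by l is  min(|γ|, r(γ) + l):  no set τ ⊆ γ of
--   nullity ≤ l exceeds r(τ) + l ≤ r(γ) + l, and padding a maximal independent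
--   subset of γ with at most l further elements of γ attains the bound.  Hence
--   n_{M_l}(γ) = n_M(γ) ∸ l, and in particular n_{M_{k+1}} = n_{M_k} ∸ 1.
--
-- * Weight coefficients under ν ↦ ν ∸ 1.  The coefficient of Z^i in P_{N,j}
--   depends on N only through its nullity function; replacing each exponent
--   ν by ν ∸ 1 sends the coefficients of Z^0 and Z^1 to Z^0 and shifts all
--   others down by one.
--
-- The theorem combines the two; its hypotheses k ≤ n - r(M) and j ≤ n are not
-- needed for the coefficient identity.
module Submission where

open import Defs
open import Data.Nat using (ℕ; suc; _≤_; _∸_)
open import Data.Integer using (_+_)
open import Data.Product using (_×_)
open import Relation.Binary.PropositionalEquality using (_≡_)

open import Data.Nat as ℕ using (zero; z≤n; s≤s; _⊔_; _⊓_; _≤ᵇ_; _≡ᵇ_)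
import Data.Nat.Properties as ℕP
open import Data.Integer using (ℤ; 0ℤ; -1ℤ; _*_; _^_)
import Data.Integer.Properties as ℤP
open import Algebra.Properties.CommutativeSemigroup ℤP.+-commutativeSemigroup using (interchange)
open import Data.Bool using (Bool; true; false; _∧_; if_then_else_)
open import Data.Bool.Properties using (T-≡)
open import Function.Bundles using (Equivalence)
open import Data.Vec using ([]; _∷_)
open import Data.List using (List; []; _∷_; map; foldr)
open import Data.List.Properties using (map-cong)
open import Data.List.Membership.Propositional using () renaming (_∈_ to _∈ₗ_)
open import Data.List.Membership.Propositional.Properties using (∈-map⁺; ∈-++⁺ˡ; ∈-++⁺ʳ)
open import Data.List.Relation.Unary.Any using (here; there)
open import Data.Product using (∃; _,_)
open import Data.Sum using (_⊎_; inj₁; inj₂)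
open import Data.Fin.Subset using (Subset; ∣_∣; ⊥)
open import Data.Fin.Subset.Properties using (∣⊥∣≡0)
open import Relation.Binary.PropositionalEquality
  using (refl; sym; trans; cong; subst; module ≡-Reasoning)

open Equivalence using (to; from)

∈-allSubsets : ∀ {n} (σ : Subset n) → σ ∈ₗ allSubsets n
∈-allSubsets [] = here refl
∈-allSubsets {suc n} (false ∷ σ) = ∈-++⁺ˡ (∈-map⁺ (false ∷_) (∈-allSubsets σ))
∈-allSubsets {suc n} (true ∷ σ) =
  ∈-++⁺ʳ (map (false ∷_) (allSubsets n)) (∈-map⁺ (true ∷_) (∈-allSubsets σ))

⊆ᵇ-trans : ∀ {n} (a b c : Subset n) → (a ⊆ᵇ b) ≡ true → (b ⊆ᵇ c) ≡ true → (a ⊆ᵇ c) ≡ true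
⊆ᵇ-trans [] [] [] _ _ = refl
⊆ᵇ-trans (false ∷ a) (false ∷ b) (_ ∷ c) p q = ⊆ᵇ-trans a b c p q
⊆ᵇ-trans (false ∷ a) (true ∷ b) (true ∷ c) p q = ⊆ᵇ-trans a b c p q
⊆ᵇ-trans (false ∷ a) (true ∷ b) (false ∷ c) _ ()
⊆ᵇ-trans (true ∷ a) (true ∷ b) (true ∷ c) p q = ⊆ᵇ-trans a b c p q
⊆ᵇ-trans (true ∷ a) (false ∷ b) (_ ∷ c) () _
⊆ᵇ-trans (true ∷ a) (true ∷ b) (false ∷ c) _ ()

⊥-⊆ᵇ : ∀ {n} (a : Subset n) → (⊥ ⊆ᵇ a) ≡ true
⊥-⊆ᵇ [] = refl
⊥-⊆ᵇ (_ ∷ a) = ⊥-⊆ᵇ a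

∣∣-mono-⊆ᵇ : ∀ {n} (a b : Subset n) → (a ⊆ᵇ b) ≡ true → ∣ a ∣ ≤ ∣ b ∣
∣∣-mono-⊆ᵇ [] [] _ = z≤n
∣∣-mono-⊆ᵇ (false ∷ a) (false ∷ b) p = ∣∣-mono-⊆ᵇ a b p
∣∣-mono-⊆ᵇ (false ∷ a) (true ∷ b) p = ℕP.m≤n⇒m≤1+n (∣∣-mono-⊆ᵇ a b p)
∣∣-mono-⊆ᵇ (true ∷ a) (true ∷ b) p = s≤s (∣∣-mono-⊆ᵇ a b p)
∣∣-mono-⊆ᵇ (true ∷ a) (false ∷ b) ()

maximum : ∀ {A : Set} → (A → ℕ) → List A → ℕ
maximum g xs = foldr _⊔_ 0 (map g xs)

maximum-lub : ∀ {A : Set} (g : A → ℕ) xs b → (∀ x → g x ≤ b) → maximum g xs ≤ b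
maximum-lub g [] b _ = z≤n
maximum-lub g (x ∷ xs) b bound = ℕP.⊔-lub (bound x) (maximum-lub g xs b bound)

maximum-ub : ∀ {A : Set} (g : A → ℕ) xs x → x ∈ₗ xs → g x ≤ maximum g xs
maximum-ub g (y ∷ xs) x (here refl) = ℕP.m≤m⊔n (g y) (maximum g xs)
maximum-ub g (y ∷ xs) x (there x∈xs) =
  ℕP.≤-trans (maximum-ub g xs x x∈xs) (ℕP.m≤n⊔m (g y) (maximum g xs))

maximum-attained : ∀ {A : Set} (g : A → ℕ) xs → maximum g xs ≡ 0 ⊎ ∃ λ x → g x ≡ maximum g xs
maximum-attained g [] = inj₁ refl
maximum-attained g (y ∷ xs) with ℕP.⊔-sel (g y) (maximum g xs)
... | inj₁ e = inj₂ (y , sym e)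
... | inj₂ e with maximum-attained g xs
...   | inj₁ z = inj₁ (trans e z)
...   | inj₂ (x , gx) = inj₂ (x , trans gx (sym e))

module Rank {n} (ind : Subset n → Bool) where

  rank-≥ : ∀ σ τ → (τ ⊆ᵇ σ) ≡ true → ind τ ≡ true → ∣ τ ∣ ≤ rankI ind σ
  rank-≥ σ τ τ⊆σ iτ = subst (_≤ rankI ind σ) term-τ
    (maximum-ub (λ ρ → if (ρ ⊆ᵇ σ) ∧ ind ρ then ∣ ρ ∣ else 0) (allSubsets n) τ (∈-allSubsets τ))
    where
    term-τ : (if (τ ⊆ᵇ σ) ∧ ind τ then ∣ τ ∣ else 0) ≡ ∣ τ ∣
    term-τ rewrite τ⊆σ | iτ = refl

  rank-≤ : ∀ σ b → (∀ τ → (τ ⊆ᵇ σ) ≡ true → ind τ ≡ true → ∣ τ ∣ ≤ b) → rankI ind σ ≤ b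
  rank-≤ σ b bound = maximum-lub _ (allSubsets n) b term-≤
    where
    term-≤ : ∀ τ → (if (τ ⊆ᵇ σ) ∧ ind τ then ∣ τ ∣ else 0) ≤ b
    term-≤ τ with τ ⊆ᵇ σ in τ⊆σ | ind τ in iτ
    ... | true | true = bound τ τ⊆σ iτ
    ... | true | false = z≤n
    ... | false | _ = z≤n

  rank-mono : ∀ σ σ' → (σ ⊆ᵇ σ') ≡ true → rankI ind σ ≤ rankI ind σ'
  rank-mono σ σ' σ⊆σ' =
    rank-≤ σ _ (λ τ τ⊆σ iτ → rank-≥ σ' τ (⊆ᵇ-trans τ σ σ' τ⊆σ σ⊆σ') iτ)

  rank-basis : ind ⊥ ≡ true →
    ∀ σ → ∃ λ B → (B ⊆ᵇ σ) ≡ true × ind B ≡ true × ∣ B ∣ ≡ rankI ind σ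
  rank-basis i⊥ σ with maximum-attained (λ ρ → if (ρ ⊆ᵇ σ) ∧ ind ρ then ∣ ρ ∣ else 0) (allSubsets n)
  ... | inj₁ r≡0 = ⊥ , ⊥-⊆ᵇ σ , i⊥ , trans (∣⊥∣≡0 n) (sym r≡0)
  ... | inj₂ (τ , e) with τ ⊆ᵇ σ in τ⊆σ | ind τ in iτ
  ...   | true | true = τ , τ⊆σ , iτ , e
  ...   | true | false = ⊥ , ⊥-⊆ᵇ σ , i⊥ , trans (∣⊥∣≡0 n) e
  ...   | false | _ = ⊥ , ⊥-⊆ᵇ σ , i⊥ , trans (∣⊥∣≡0 n) e

pad : ∀ {n} → Subset n → Subset n → ℕ → Subset n
pad [] [] m = []
pad (true ∷ B) (_ ∷ G) m = true ∷ pad B G m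
pad (false ∷ B) (false ∷ G) m = false ∷ pad B G m
pad (false ∷ B) (true ∷ G) zero = false ∷ pad B G zero
pad (false ∷ B) (true ∷ G) (suc m) = true ∷ pad B G m

pad-⊇ : ∀ {n} (B G : Subset n) m → (B ⊆ᵇ pad B G m) ≡ true
pad-⊇ [] [] m = refl
pad-⊇ (true ∷ B) (_ ∷ G) m = pad-⊇ B G m
pad-⊇ (false ∷ B) (false ∷ G) m = pad-⊇ B G m
pad-⊇ (false ∷ B) (true ∷ G) zero = pad-⊇ B G zero
pad-⊇ (false ∷ B) (true ∷ G) (suc m) = pad-⊇ B G m

pad-⊆ : ∀ {n} (B G : Subset n) m → (B ⊆ᵇ G) ≡ true → (pad B G m ⊆ᵇ G) ≡ true
pad-⊆ [] [] m _ = refl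
pad-⊆ (true ∷ B) (true ∷ G) m p = pad-⊆ B G m p
pad-⊆ (true ∷ B) (false ∷ G) m ()
pad-⊆ (false ∷ B) (false ∷ G) m p = pad-⊆ B G m p
pad-⊆ (false ∷ B) (true ∷ G) zero p = pad-⊆ B G zero p
pad-⊆ (false ∷ B) (true ∷ G) (suc m) p = pad-⊆ B G m p

∣pad∣ : ∀ {n} (B G : Subset n) m → (B ⊆ᵇ G) ≡ true →
  ∣ pad B G m ∣ ≡ ∣ B ∣ ℕ.+ (m ⊓ (∣ G ∣ ∸ ∣ B ∣))
∣pad∣ [] [] m _ = sym (ℕP.⊓-zeroʳ m)
∣pad∣ (true ∷ B) (true ∷ G) m p = cong suc (∣pad∣ B G m p)
∣pad∣ (true ∷ B) (false ∷ G) m ()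
∣pad∣ (false ∷ B) (false ∷ G) m p = ∣pad∣ B G m p
∣pad∣ (false ∷ B) (true ∷ G) zero p = ∣pad∣ B G zero p
∣pad∣ (false ∷ B) (true ∷ G) (suc m) p = begin
    suc ∣ pad B G m ∣
  ≡⟨ cong suc (∣pad∣ B G m p) ⟩
    suc (∣ B ∣ ℕ.+ (m ⊓ (∣ G ∣ ∸ ∣ B ∣)))
  ≡⟨ sym (ℕP.+-suc ∣ B ∣ _) ⟩
    ∣ B ∣ ℕ.+ (suc m ⊓ suc (∣ G ∣ ∸ ∣ B ∣))
  ≡⟨ cong (λ t → ∣ B ∣ ℕ.+ (suc m ⊓ t)) (sym (ℕP.+-∸-assoc 1 (∣∣-mono-⊆ᵇ B G p))) ⟩
    ∣ B ∣ ℕ.+ (suc m ⊓ (suc ∣ G ∣ ∸ ∣ B ∣))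
  ∎
  where open ≡-Reasoning

elongationI : ∀ {n} → (Subset n → Bool) → ℕ → Subset n → Bool
elongationI ind l σ = nullityI ind σ ≤ᵇ l

r+[l⊓[g∸r]]≡g⊓[r+l] : ∀ r g l → r ≤ g → r ℕ.+ (l ⊓ (g ∸ r)) ≡ g ⊓ (r ℕ.+ l)
r+[l⊓[g∸r]]≡g⊓[r+l] r g l r≤g = begin
  r ℕ.+ (l ⊓ (g ∸ r))             ≡⟨ ℕP.+-distribˡ-⊓ r l (g ∸ r) ⟩
  (r ℕ.+ l) ⊓ (r ℕ.+ (g ∸ r))     ≡⟨ cong ((r ℕ.+ l) ⊓_) (ℕP.m+[n∸m]≡n r≤g) ⟩
  (r ℕ.+ l) ⊓ g                   ≡⟨ ℕP.⊓-comm (r ℕ.+ l) g ⟩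
  g ⊓ (r ℕ.+ l)                   ∎
  where open ≡-Reasoning

g∸[g⊓x]≡g∸x : ∀ g x → g ∸ (g ⊓ x) ≡ g ∸ x
g∸[g⊓x]≡g∸x g x = trans (ℕP.∸-distribˡ-⊓-⊔ g g x) (cong (_⊔ (g ∸ x)) (ℕP.n∸n≡0 g))

module Elongation {n} (ind : Subset n → Bool) (ind-⊥ : ind ⊥ ≡ true) (l : ℕ) (γ : Subset n) where
  open Rank

  private
    g = ∣ γ ∣
    r = rankI ind γ

  -- A set of nullity ≤ l inside γ has at most r(τ) + l ≤ r(γ) + l elements.
  elongation-rank-≤ : rankI (elongationI ind l) γ ≤ g ⊓ (r ℕ.+ l)
  elongation-rank-≤ = rank-≤ (elongationI ind l) γ _ bound
    where
    bound : ∀ τ → (τ ⊆ᵇ γ) ≡ true → elongationI ind l τ ≡ true → ∣ τ ∣ ≤ g ⊓ (r ℕ.+ l)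
    bound τ τ⊆γ τ-el = ℕP.⊓-glb (∣∣-mono-⊆ᵇ τ γ τ⊆γ)
      (ℕP.≤-trans (ℕP.m≤n+m∸n ∣ τ ∣ (rankI ind τ))
        (ℕP.+-mono-≤ (rank-mono ind τ γ τ⊆γ) (ℕP.≤ᵇ⇒≤ _ l (from T-≡ τ-el))))

  -- Padding a basis B of γ by l elements of γ gives a set of nullity ≤ l.
  elongation-rank-≥ : g ⊓ (r ℕ.+ l) ≤ rankI (elongationI ind l) γ
  elongation-rank-≥ with rank-basis ind ind-⊥ γ
  ... | B , B⊆γ , iB , ∣B∣≡r =
    subst (_≤ rankI (elongationI ind l) γ) ∣τ∣≡g⊓[r+l]
      (rank-≥ (elongationI ind l) γ τ (pad-⊆ B γ l B⊆γ) (to T-≡ (ℕP.≤⇒≤ᵇ nullity-τ≤l)))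
    where
    τ = pad B γ l
    added = l ⊓ (g ∸ r)

    ∣τ∣≡r+added : ∣ τ ∣ ≡ r ℕ.+ added
    ∣τ∣≡r+added = trans (∣pad∣ B γ l B⊆γ) (cong (λ t → t ℕ.+ (l ⊓ (g ∸ t))) ∣B∣≡r)

    ∣τ∣≡g⊓[r+l] : ∣ τ ∣ ≡ g ⊓ (r ℕ.+ l)
    ∣τ∣≡g⊓[r+l] = trans ∣τ∣≡r+added
      (r+[l⊓[g∸r]]≡g⊓[r+l] r g l (subst (_≤ g) ∣B∣≡r (∣∣-mono-⊆ᵇ B γ B⊆γ)))

    r≤rank-τ : r ≤ rankI ind τ
    r≤rank-τ = subst (_≤ rankI ind τ) ∣B∣≡r (rank-≥ ind τ B (pad-⊇ B γ l) iB)

    nullity-τ≤l : nullityI ind τ ≤ l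
    nullity-τ≤l = begin
      ∣ τ ∣ ∸ rankI ind τ    ≤⟨ ℕP.∸-monoʳ-≤ ∣ τ ∣ r≤rank-τ ⟩
      ∣ τ ∣ ∸ r              ≡⟨ cong (_∸ r) ∣τ∣≡r+added ⟩
      r ℕ.+ added ∸ r        ≡⟨ ℕP.m+n∸m≡n r added ⟩
      added                  ≤⟨ ℕP.m⊓n≤m l (g ∸ r) ⟩
      l                      ∎
      where open ℕP.≤-Reasoning

  elongation-nullity : nullityI (elongationI ind l) γ ≡ nullityI ind γ ∸ l
  elongation-nullity = begin
    g ∸ rankI (elongationI ind l) γ   ≡⟨ cong (g ∸_) (ℕP.≤-antisym elongation-rank-≤ elongation-rank-≥) ⟩
    g ∸ (g ⊓ (r ℕ.+ l))               ≡⟨ g∸[g⊓x]≡g∸x g (r ℕ.+ l) ⟩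
    g ∸ (r ℕ.+ l)                     ≡⟨ sym (ℕP.∸-+-assoc g r l) ⟩
    g ∸ r ∸ l                         ∎
    where open ≡-Reasoning

elongation-nullity-step : ∀ {n} (ind : Subset n → Bool) → ind ⊥ ≡ true → ∀ l γ →
  nullityI (elongationI ind (suc l)) γ ≡ nullityI (elongationI ind l) γ ∸ 1
elongation-nullity-step ind ind-⊥ l γ = begin
  nullityI (elongationI ind (suc l)) γ   ≡⟨ Elongation.elongation-nullity ind ind-⊥ (suc l) γ ⟩
  ν ∸ suc l                               ≡⟨ cong (ν ∸_) (ℕP.+-comm 1 l) ⟩
  ν ∸ (l ℕ.+ 1)                           ≡⟨ sym (ℕP.∸-+-assoc ν l 1) ⟩
  ν ∸ l ∸ 1                               ≡⟨ cong (_∸ 1) (sym (Elongation.elongation-nullity ind ind-⊥ l γ)) ⟩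
  nullityI (elongationI ind l) γ ∸ 1      ∎
  where
  open ≡-Reasoning
  ν = nullityI ind γ

sumℤ-cong : ∀ {A : Set} (xs : List A) {f h : A → ℤ} → (∀ x → f x ≡ h x) →
  sumℤ (map f xs) ≡ sumℤ (map h xs)
sumℤ-cong xs f≗h = cong sumℤ (map-cong f≗h xs)

sumℤ-+ : ∀ {A : Set} (xs : List A) (f h : A → ℤ) →
  sumℤ (map (λ x → f x + h x) xs) ≡ sumℤ (map f xs) + sumℤ (map h xs)
sumℤ-+ [] f h = refl
sumℤ-+ (x ∷ xs) f h = trans (cong (f x + h x +_) (sumℤ-+ xs f h))
  (interchange (f x) (h x) (sumℤ (map f xs)) (sumℤ (map h xs)))

sumℤ-if-+ : ∀ {A : Set} (xs : List A) (Q : A → Bool) (f h : A → ℤ) →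
  sumℤ (map (λ x → if Q x then f x + h x else 0ℤ) xs)
    ≡ sumℤ (map (λ x → if Q x then f x else 0ℤ) xs) + sumℤ (map (λ x → if Q x then h x else 0ℤ) xs)
sumℤ-if-+ xs Q f h = trans (sumℤ-cong xs split) (sumℤ-+ xs _ _)
  where
  split : ∀ x → (if Q x then f x + h x else 0ℤ)
                ≡ (if Q x then f x else 0ℤ) + (if Q x then h x else 0ℤ)
  split x with Q x
  ... | true = refl
  ... | false = refl

-- Coefficient of Z^i in the polynomial  Σ_{x ∈ xs, P x} w(x) Z^{ν(x)}.
coeff : ∀ {A : Set} → List A → (A → Bool) → (A → ℕ) → (A → ℤ) → ℕ → ℤ
coeff xs P ν w i = sumℤ (map (λ x → if P x ∧ (ν x ≡ᵇ i) then w x else 0ℤ) xs)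

coeff-cong : ∀ {A : Set} xs (P : A → Bool) {ν μ : A → ℕ} w i → (∀ x → ν x ≡ μ x) →
  coeff xs P ν w i ≡ coeff xs P μ w i
coeff-cong xs P w i ν≗μ = sumℤ-cong xs (λ x → cong (λ t → if P x ∧ (t ≡ᵇ i) then w x else 0ℤ) (ν≗μ x))

coeff-pred-0 : ∀ {A : Set} xs (P : A → Bool) ν w →
  coeff xs P (λ x → ν x ∸ 1) w 0 ≡ coeff xs P ν w 1 + coeff xs P ν w 0
coeff-pred-0 xs P ν w = trans (sumℤ-cong xs merge) (sumℤ-+ xs _ _)
  where
  merge : ∀ x → (if P x ∧ ((ν x ∸ 1) ≡ᵇ 0) then w x else 0ℤ)
              ≡ (if P x ∧ (ν x ≡ᵇ 1) then w x else 0ℤ) + (if P x ∧ (ν x ≡ᵇ 0) then w x else 0ℤ)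
  merge x with P x | ν x
  ... | false | _ = refl
  ... | true | zero = sym (ℤP.+-identityˡ (w x))
  ... | true | suc zero = sym (ℤP.+-identityʳ (w x))
  ... | true | suc (suc _) = refl

coeff-pred-suc : ∀ {A : Set} xs (P : A → Bool) ν w i →
  coeff xs P (λ x → ν x ∸ 1) w (suc i) ≡ coeff xs P ν w (suc (suc i))
coeff-pred-suc xs P ν w i = sumℤ-cong xs shift
  where
  shift : ∀ x → (if P x ∧ ((ν x ∸ 1) ≡ᵇ suc i) then w x else 0ℤ)
              ≡ (if P x ∧ (ν x ≡ᵇ suc (suc i)) then w x else 0ℤ)
  shift x with ν x
  ... | zero = refl
  ... | suc _ = refl

weightCoeff-pred : ∀ {n} (ind ind' : Subset n → Bool) →
  (∀ γ → nullityI ind γ ≡ nullityI ind' γ ∸ 1) → ∀ j →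
  (weightCoeff ind j 0 ≡ weightCoeff ind' j 1 + weightCoeff ind' j 0)
  × (∀ i → weightCoeff ind j (suc i) ≡ weightCoeff ind' j (suc (suc i)))
weightCoeff-pred ind ind' null-pred zero = refl , λ _ → refl
weightCoeff-pred {n} ind ind' null-pred (suc j) = constant-term , higher-terms
  where
  open ≡-Reasoning
  L = allSubsets n
  sign = -1ℤ ^ suc j
  ν' = nullityI ind'

  inner : (Subset n → ℕ) → ℕ → Subset n → ℤ
  inner ν i σ = coeff L (_⊆ᵇ σ) ν (λ γ → -1ℤ ^ ∣ γ ∣) i

  overSize : (Subset n → ℤ) → ℤ
  overSize f = sumℤ (map (λ σ → if ∣ σ ∣ ≡ᵇ suc j then f σ else 0ℤ) L)

  outer : (Subset n → ℤ) → ℤ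
  outer f = sign * overSize f

  inner-pred : ∀ i σ → inner (nullityI ind) i σ ≡ inner (λ γ → ν' γ ∸ 1) i σ
  inner-pred i σ = coeff-cong L (_⊆ᵇ σ) _ i null-pred

  outer-cong : ∀ {f h} → (∀ σ → f σ ≡ h σ) → outer f ≡ outer h
  outer-cong f≗h = cong (sign *_) (sumℤ-cong L (λ σ → cong (λ t → if ∣ σ ∣ ≡ᵇ suc j then t else 0ℤ) (f≗h σ)))

  constant-term : outer (inner (nullityI ind) 0) ≡ outer (inner ν' 1) + outer (inner ν' 0)
  constant-term = begin
    outer (inner (nullityI ind) 0)
      ≡⟨ outer-cong (λ σ → trans (inner-pred 0 σ) (coeff-pred-0 L (_⊆ᵇ σ) ν' _)) ⟩
    outer (λ σ → inner ν' 1 σ + inner ν' 0 σ)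
      ≡⟨ cong (sign *_) (sumℤ-if-+ L (λ σ → ∣ σ ∣ ≡ᵇ suc j) _ _) ⟩
    sign * (overSize (inner ν' 1) + overSize (inner ν' 0))
      ≡⟨ ℤP.*-distribˡ-+ sign (overSize (inner ν' 1)) (overSize (inner ν' 0)) ⟩
    outer (inner ν' 1) + outer (inner ν' 0)
      ∎

  higher-terms : ∀ i → outer (inner (nullityI ind) (suc i)) ≡ outer (inner ν' (suc (suc i)))
  higher-terms i = outer-cong (λ σ → trans (inner-pred (suc i) σ) (coeff-pred-suc L (_⊆ᵇ σ) ν' _ i))

proposition4 : (n : ℕ) (M : Matroid n) (k j : ℕ) →
    1 ≤ k → k ≤ n ∸ rk M → j ≤ n →
    (weightCoeff (elongation M k) j 0
        ≡ weightCoeff (elongation M (k ∸ 1)) j 1 + weightCoeff (elongation M (k ∸ 1)) j 0)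
    × ((i : ℕ) → weightCoeff (elongation M k) j (suc i)
        ≡ weightCoeff (elongation M (k ∸ 1)) j (suc (suc i)))
proposition4 n M (suc k) j _ _ _ =
  weightCoeff-pred (elongation M (suc k)) (elongation M k)
    (elongation-nullity-step (indep M) (indep-⊥ M) k) j
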